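{- Let $G$ be a $4$-regular graph on $n\ge 7$ vertices and let $G'$ be the labeled complete graph on $V(G)$ whose $+$ edges are exactly the edges of $G$. Let $H$ be the labeled complete graph obtained from $G'$ by adding, for every $3$-subset $\{u,v,w\}\subseteq V(G')$, a new set $C_{uvw}$ of $7$ vertices such that all edges within $C_{uvw}$ are $+$, all edges from $C_{uvw}$ to $u,v,w$ are $+$, and all other edges incident to $C_{uvw}$ are $-$. Assign tolerances $t_u=7\left(\binom{n-1}{2}-1\right)+2$ to each $u\in V(G')$ and $t_v=3$ to each added vertex $v$. If $H$ has a $t$-perfect clustering $\mathcal{C}$, then every cluster of $\mathcal{C}$ contains at most three vertices of $G'$, and every cluster of $\mathcal{C}$ contains vertices from exactly one of the cliques $C_{uvw}$.
   Context: A clustering is a partition of the vertex set. Given a clustering, an error (mistake) is a $+$ edge between different clusters or a $-$ edge within a cluster. A clustering is $t$-perfect if each vertex $v$ is incident to at most $t_v$ errors. -}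

module Defs where

open import Data.Nat using (ℕ; zero; suc; _+_; _*_; _∸_; _≤_)
open import Data.Nat.Combinatorics using (_C_)
open import Data.Fin using (Fin; zero; suc; _<_)
open import Data.Fin.Properties using (_<?_) renaming (_≟_ to _≟F_)
open import Data.Bool using (Bool; true; false; if_then_else_; _∨_; _∧_; not)
open import Data.Sum using (_⊎_; inj₁; inj₂)
open import Data.Product using (_×_; _,_)
open import Relation.Nullary using (yes; no)
open import Relation.Nullary.Decidable using (⌊_⌋)
open import Relation.Binary.PropositionalEquality using (_≡_)
import Data.Nat as N

sumF : (n : ℕ) → (Fin n → ℕ) → ℕ
sumF zero    f = 0
sumF (suc n) f = f zero + sumF n (λ i → f (suc i))

-- A 3-subset {a,b,c} of Fin n, represented canonically with a < b < c
record Triple (n : ℕ) : Set where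
  constructor tri
  field
    a b c : Fin n
    a<b : a < b
    b<c : b < c
open Triple public

atTriple : {n : ℕ} → (Triple n → ℕ) → Fin n → Fin n → Fin n → ℕ
atTriple f x y z with x <? y | y <? z
... | yes p | yes q = f (tri x y z p q)
... | _     | _     = 0

sumTriples : (n : ℕ) → (Triple n → ℕ) → ℕ
sumTriples n f = sumF n (λ x → sumF n (λ y → sumF n (λ z → atTriple f x y z)))

Symmetric : {n : ℕ} → (Fin n → Fin n → Bool) → Set
Symmetric adj = ∀ x y → adj x y ≡ adj y x

Irreflexive : {n : ℕ} → (Fin n → Fin n → Bool) → Set
Irreflexive adj = ∀ x → adj x x ≡ false

degree : {n : ℕ} → (Fin n → Fin n → Bool) → Fin n → ℕ
degree {n} adj x = sumF n (λ y → if adj x y then 1 else 0)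

FourRegularGraph : {n : ℕ} → (Fin n → Fin n → Bool) → Set
FourRegularGraph adj = Symmetric adj × Irreflexive adj × (∀ x → degree adj x ≡ 4)

-- Vertices of H: vertices of G' plus, for each 3-subset t, the 7 vertices C_t
HV : ℕ → Set
HV n = Fin n ⊎ (Triple n × Fin 7)

sumV : (n : ℕ) → (HV n → ℕ) → ℕ
sumV n f = sumF n (λ x → f (inj₁ x))
         + sumTriples n (λ t → sumF 7 (λ i → f (inj₂ (t , i))))

memb : {n : ℕ} → Fin n → Triple n → Bool
memb x t = ⌊ x ≟F a t ⌋ ∨ ⌊ x ≟F b t ⌋ ∨ ⌊ x ≟F c t ⌋

eqT : {n : ℕ} → Triple n → Triple n → Bool
eqT s t = ⌊ a s ≟F a t ⌋ ∧ ⌊ b s ≟F b t ⌋ ∧ ⌊ c s ≟F c t ⌋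

eqV : {n : ℕ} → HV n → HV n → Bool
eqV (inj₁ x) (inj₁ y) = ⌊ x ≟F y ⌋
eqV (inj₁ x) (inj₂ _) = false
eqV (inj₂ _) (inj₁ y) = false
eqV (inj₂ (s , i)) (inj₂ (t , j)) = eqT s t ∧ ⌊ i ≟F j ⌋

-- Labels of H (true = +, false = −)
sign : {n : ℕ} → (Fin n → Fin n → Bool) → HV n → HV n → Bool
sign adj (inj₁ x) (inj₁ y) = adj x y
sign adj (inj₁ x) (inj₂ (t , _)) = memb x t
sign adj (inj₂ (t , _)) (inj₁ y) = memb y t
sign adj (inj₂ (s , _)) (inj₂ (t , _)) = eqT s t

-- A clustering is given by cluster labels; v, w in the same cluster iff cl v ≡ cl w
sameC : {n : ℕ} → (HV n → ℕ) → HV n → HV n → Bool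
sameC cl v w = ⌊ cl v N.≟ cl w ⌋

errPair : {n : ℕ} → (Fin n → Fin n → Bool) → (HV n → ℕ) → HV n → HV n → ℕ
errPair adj cl v w =
  if eqV v w then 0
  else (if sign adj v w
        then (if sameC cl v w then 0 else 1)
        else (if sameC cl v w then 1 else 0))

errors : {n : ℕ} → (Fin n → Fin n → Bool) → (HV n → ℕ) → HV n → ℕ
errors {n} adj cl v = sumV n (errPair adj cl v)

tol : (n : ℕ) → HV n → ℕ
tol n (inj₁ _) = 7 * (((n ∸ 1) C 2) ∸ 1) + 2
tol n (inj₂ _) = 3

TPerfect : {n : ℕ} → (Fin n → Fin n → Bool) → (HV n → ℕ) → Set
TPerfect {n} adj cl = ∀ v → errors adj cl v ≤ tol n v

countG' : {n : ℕ} → (HV n → ℕ) → HV n → ℕ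
countG' {n} cl v = sumF n (λ x → if sameC cl (inj₁ x) v then 1 else 0)

module Submission where

-- The proof only counts errors.
--  * A clique vertex tolerates 3 errors.  If C_t were split between clusters,
--    two of its vertices p, q are apart and each of the 7 vertices of C_t is
--    cut from p or from q: 7 errors against a budget of 3 + 3.  If a vertex
--    of C_t shared its cluster with C_s, s ≠ t, it would keep 7 − edges.
--    Hence every cluster meets at most one clique.
--  * A vertex u of G' lies in (n−1 choose 2) triples, each joined to u by 7
--    + edges.  If u shared its cluster with no clique of such a triple, it
--    would have 7 (n−1 choose 2) > t_u errors.  So u is clustered with C_s
--    for some s ∋ u, and this C_s is the unique clique of u's cluster; thus
--    every cluster meets a clique, and its G'-vertices lie in one triple.

open import Defs
open import Data.Nat using (ℕ; _≤_)
open import Data.Fin using (Fin)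
open import Data.Bool using (Bool)
open import Data.Sum using (inj₂)
open import Data.Product using (_×_; _,_; ∃-syntax)
open import Relation.Binary.PropositionalEquality using (_≡_)

open import Data.Nat as ℕ using (zero; suc; _+_; _*_; _∸_; _<_; z≤n; s≤s; z<s; s<s)
open import Data.Nat.Properties
  using (≤-refl; ≤-reflexive; ≤-trans; m≤m+n; m≤n+m; +-mono-≤; +-monoʳ-<; +-comm;
         *-suc; *-zeroʳ; *-identityʳ; *-monoʳ-≤; +-identityʳ; *-distribˡ-+; 1+n≰n; <⇒≱; n≢0⇒n>0;
         +-commutativeSemigroup; module ≤-Reasoning)
open import Algebra.Properties.CommutativeSemigroup +-commutativeSemigroup using (interchange)
open import Data.Nat.Combinatorics using (_C_; nC1≡n; nCk+nC[k+1]≡[n+1]C[k+1])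
open import Data.Fin using (zero; suc)
open import Data.Fin.Properties using (_<?_; <-irrelevant) renaming (_≟_ to _≟F_)
open import Data.Bool using (true; false; if_then_else_; _∨_; _∧_)
open import Data.Sum using (_⊎_; inj₁)
open import Relation.Nullary using (Dec; yes; no; does; contradiction)
open import Relation.Nullary.Decidable using (⌊_⌋; dec-true; dec-false)
open import Relation.Binary.PropositionalEquality using (_≢_; refl; sym; trans; cong; cong₂; subst)

𝟙 : Bool → ℕ
𝟙 b = if b then 1 else 0

𝟙-mono : ∀ {b c} → (b ≡ true → c ≡ true) → 𝟙 b ≤ 𝟙 c
𝟙-mono {false} _ = z≤n
𝟙-mono {true} b⇒c rewrite b⇒c refl = ≤-refl

𝟙-∨ : ∀ b c → 𝟙 (b ∨ c) ≤ 𝟙 b + 𝟙 c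
𝟙-∨ true c = s≤s z≤n
𝟙-∨ false c = ≤-refl

both-true : ∀ {b c} → 0 < 𝟙 (b ∧ c) → (b ≡ true) × (c ≡ true)
both-true {true} {true} _ = refl , refl
both-true {true} {false} ()
both-true {false} ()

sumF-cong : ∀ n {f g : Fin n → ℕ} → (∀ i → f i ≡ g i) → sumF n f ≡ sumF n g
sumF-cong zero    f≡g = refl
sumF-cong (suc n) f≡g = cong₂ _+_ (f≡g zero) (sumF-cong n (λ i → f≡g (suc i)))

sumF-mono : ∀ n {f g : Fin n → ℕ} → (∀ i → f i ≤ g i) → sumF n f ≤ sumF n g
sumF-mono zero    f≤g = z≤n
sumF-mono (suc n) f≤g = +-mono-≤ (f≤g zero) (sumF-mono n (λ i → f≤g (suc i)))

sumF-+ : ∀ n (f g : Fin n → ℕ) → sumF n (λ i → f i + g i) ≡ sumF n f + sumF n g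
sumF-+ zero    f g = refl
sumF-+ (suc n) f g =
  trans (cong (f zero + g zero +_) (sumF-+ n (λ i → f (suc i)) (λ i → g (suc i))))
        (interchange (f zero) (g zero) _ _)

sumF-scale : ∀ n k (f : Fin n → ℕ) → sumF n (λ i → k * f i) ≡ k * sumF n f
sumF-scale zero    k f = sym (*-zeroʳ k)
sumF-scale (suc n) k f =
  trans (cong (k * f zero +_) (sumF-scale n k (λ i → f (suc i))))
        (sym (*-distribˡ-+ k (f zero) _))

sumF-const : ∀ n k → sumF n (λ _ → k) ≡ n * k
sumF-const zero    k = refl
sumF-const (suc n) k = cong (k +_) (sumF-const n k)

sumF-single : ∀ n (f : Fin n → ℕ) i → f i ≤ sumF n f
sumF-single (suc n) f zero    = m≤m+n (f zero) _
sumF-single (suc n) f (suc i) = ≤-trans (sumF-single n (λ j → f (suc j)) i) (m≤n+m _ (f zero))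

sumF-positive : ∀ n (f : Fin n → ℕ) → 0 < sumF n f → ∃[ i ] 0 < f i
sumF-positive (suc n) f pos with f zero in f0
... | suc _ = zero , subst (0 <_) (sym f0) z<s
... | zero with sumF-positive n (λ i → f (suc i)) pos
...   | i , fi>0 = suc i , fi>0

sumF³ : ∀ n → (Fin n → Fin n → Fin n → ℕ) → ℕ
sumF³ n h = sumF n (λ x → sumF n (λ y → sumF n (λ z → h x y z)))

sumF³-cong : ∀ n {h k : Fin n → Fin n → Fin n → ℕ} → (∀ x y z → h x y z ≡ k x y z) →
             sumF³ n h ≡ sumF³ n k
sumF³-cong n h≡k = sumF-cong n (λ x → sumF-cong n (λ y → sumF-cong n (λ z → h≡k x y z)))

sumF³-mono : ∀ n {h k : Fin n → Fin n → Fin n → ℕ} → (∀ x y z → h x y z ≤ k x y z) →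
             sumF³ n h ≤ sumF³ n k
sumF³-mono n h≤k = sumF-mono n (λ x → sumF-mono n (λ y → sumF-mono n (λ z → h≤k x y z)))

sumF³-+ : ∀ n (h k : Fin n → Fin n → Fin n → ℕ) →
          sumF³ n (λ x y z → h x y z + k x y z) ≡ sumF³ n h + sumF³ n k
sumF³-+ n h k =
  trans (sumF-cong n (λ x → trans (sumF-cong n (λ y → sumF-+ n (h x y) (k x y))) (sumF-+ n _ _)))
        (sumF-+ n _ _)

sumF³-scale : ∀ n m (h : Fin n → Fin n → Fin n → ℕ) →
              sumF³ n (λ x y z → m * h x y z) ≡ m * sumF³ n h
sumF³-scale n m h =
  trans (sumF-cong n (λ x → trans (sumF-cong n (λ y → sumF-scale n m (h x y))) (sumF-scale n m _)))
        (sumF-scale n m _)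

sumF³-single : ∀ n (h : Fin n → Fin n → Fin n → ℕ) x y z → h x y z ≤ sumF³ n h
sumF³-single n h x y z = begin
  h x y z                                 ≤⟨ sumF-single n (h x y) z ⟩
  sumF n (h x y)                          ≤⟨ sumF-single n (λ y′ → sumF n (h x y′)) y ⟩
  sumF n (λ y′ → sumF n (h x y′))         ≤⟨ sumF-single n (λ x′ → sumF n (λ y′ → sumF n (h x′ y′))) x ⟩
  sumF³ n h                               ∎
  where open ≤-Reasoning

sumF³-positive : ∀ n (h : Fin n → Fin n → Fin n → ℕ) → 0 < sumF³ n h →
                 ∃[ x ] ∃[ y ] ∃[ z ] 0 < h x y z
sumF³-positive n h pos with sumF-positive n _ pos
... | x , pos-x with sumF-positive n _ pos-x
... | y , pos-y with sumF-positive n (h x y) pos-y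
... | z , pos-z = x , y , z , pos-z

-- Sums over 3-subsets: sumTriples n f = sumF³ n (atTriple f) counts each
-- 3-subset t once, at the ordered position (a t, b t, c t); every other
-- position contributes 0.

atTriple-mono : ∀ {n} {f g : Triple n → ℕ} → (∀ t → f t ≤ g t) →
                ∀ x y z → atTriple f x y z ≤ atTriple g x y z
atTriple-mono f≤g x y z with x <? y | y <? z
... | yes _ | yes _ = f≤g _
... | yes _ | no _  = z≤n
... | no _  | _     = z≤n

atTriple-+ : ∀ {n} (f g : Triple n → ℕ) x y z →
             atTriple (λ t → f t + g t) x y z ≡ atTriple f x y z + atTriple g x y z
atTriple-+ f g x y z with x <? y | y <? z
... | yes _ | yes _ = refl
... | yes _ | no _  = refl
... | no _  | _     = refl

atTriple-scale : ∀ {n} m (f : Triple n → ℕ) x y z →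
                 atTriple (λ t → m * f t) x y z ≡ m * atTriple f x y z
atTriple-scale m f x y z with x <? y | y <? z
... | yes _ | yes _ = refl
... | yes _ | no _  = sym (*-zeroʳ m)
... | no _  | _     = sym (*-zeroʳ m)

atTriple-positive : ∀ {n} (f : Triple n → ℕ) x y z → 0 < atTriple f x y z → ∃[ t ] 0 < f t
atTriple-positive f x y z pos with x <? y | y <? z
... | yes _ | yes _ = _ , pos

atTriple-canonical : ∀ {n} (f : Triple n → ℕ) t → atTriple f (a t) (b t) (c t) ≡ f t
atTriple-canonical f (tri x y z x<y y<z) with x <? y | y <? z
... | yes x<y′ | yes y<z′ = cong f (cong₂ (tri x y z) (<-irrelevant x<y′ x<y) (<-irrelevant y<z′ y<z))
... | yes _    | no y≮z   = contradiction y<z y≮z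
... | no x≮y   | _        = contradiction x<y x≮y

atTriple-vertices : ∀ {n} (f : Triple n → ℕ) (g : Fin n → Fin n → Fin n → ℕ) →
  (∀ t → f t ≡ g (a t) (b t) (c t)) →
  ∀ x y z → atTriple f x y z ≡ (if does (x <? y) ∧ does (y <? z) then g x y z else 0)
atTriple-vertices f g f≡g x y z with x <? y | y <? z
... | yes x<y | yes y<z rewrite dec-true (x <? y) x<y | dec-true (y <? z) y<z = f≡g _
... | yes x<y | no y≮z  rewrite dec-true (x <? y) x<y | dec-false (y <? z) y≮z = refl
... | no x≮y  | _       rewrite dec-false (x <? y) x≮y = refl

sumTriples-mono : ∀ n {f g : Triple n → ℕ} → (∀ t → f t ≤ g t) → sumTriples n f ≤ sumTriples n g
sumTriples-mono n f≤g = sumF³-mono n (atTriple-mono f≤g)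

sumTriples-+ : ∀ n (f g : Triple n → ℕ) →
               sumTriples n (λ t → f t + g t) ≡ sumTriples n f + sumTriples n g
sumTriples-+ n f g = trans (sumF³-cong n (atTriple-+ f g)) (sumF³-+ n (atTriple f) (atTriple g))

sumTriples-scale : ∀ n m (f : Triple n → ℕ) → sumTriples n (λ t → m * f t) ≡ m * sumTriples n f
sumTriples-scale n m f = trans (sumF³-cong n (atTriple-scale m f)) (sumF³-scale n m (atTriple f))

sumTriples-single : ∀ n (f : Triple n → ℕ) t → f t ≤ sumTriples n f
sumTriples-single n f t =
  subst (_≤ sumTriples n f) (atTriple-canonical f t) (sumF³-single n (atTriple f) (a t) (b t) (c t))

sumTriples-positive : ∀ n (f : Triple n → ℕ) → 0 < sumTriples n f → ∃[ t ] 0 < f t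
sumTriples-positive n f pos with sumF³-positive n (atTriple f) pos
... | x , y , z , pos-xyz = atTriple-positive f x y z pos-xyz

-- Since does (suc x <? suc y) and does (suc x ≟F suc y) reduce to
-- does (x <? y) and does (x ≟F y), the counts below obey recursions in n
-- obtained by splitting off the index zero.  (The stuck form ⌊ d ⌋ does not
-- reduce this way, hence the conversion memb-does.)

isYes≡does : ∀ {P : Set} (d : Dec P) → ⌊ d ⌋ ≡ does d
isYes≡does (yes _) = refl
isYes≡does (no _)  = refl

memb-does : ∀ {n} (x : Fin n) t → memb x t ≡ (does (x ≟F a t) ∨ does (x ≟F b t) ∨ does (x ≟F c t))
memb-does x t =
  cong₂ _∨_ (isYes≡does (x ≟F a t)) (cong₂ _∨_ (isYes≡does (x ≟F b t)) (isYes≡does (x ≟F c t)))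

pascal₂ : ∀ m → m + m C 2 ≡ suc m C 2
pascal₂ m = trans (cong (_+ m C 2) (sym (nC1≡n m))) (nCk+nC[k+1]≡[n+1]C[k+1] m 1)

pairs : ℕ → ℕ
pairs n = sumF n (λ y → sumF n (λ z → 𝟙 (does (y <? z))))

pairs≡ : ∀ n → pairs n ≡ n C 2
pairs≡ zero    = refl
pairs≡ (suc n) = trans (cong₂ _+_ (trans (sumF-const n 1) (*-identityʳ n)) (pairs≡ n)) (pascal₂ n)

-- Ordered pairs y < z in Fin n with j ∈ {y, z}; for n ≥ 1 there are at
-- least n − 1 of them (the pairs {j, w} with w ≠ j).
pairTerm : ∀ {n} → Fin n → Fin n → Fin n → ℕ
pairTerm j y z = if does (y <? z) then 𝟙 (does (j ≟F y) ∨ does (j ≟F z)) else 0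

pairsThrough : ∀ n → Fin n → ℕ
pairsThrough n j = sumF n (λ y → sumF n (pairTerm j y))

pairsThrough≥ : ∀ n (j : Fin (suc n)) → n ≤ pairsThrough (suc n) j
pairsThrough≥ n zero = begin
  n                                          ≡⟨ trans (sumF-const n 1) (*-identityʳ n) ⟨
  sumF n (λ _ → 1)                           ≤⟨ m≤m+n _ (sumF n (λ y → sumF (suc n) (pairTerm zero (suc y)))) ⟩
  pairsThrough (suc n) zero                  ∎
  where open ≤-Reasoning
pairsThrough≥ (suc n) (suc j) = +-mono-≤ j-hits (pairsThrough≥ n j)
  where
  j-hits : 1 ≤ sumF (suc n) (λ z → 𝟙 (does (j ≟F z)))
  j-hits = subst (_≤ sumF (suc n) (λ z → 𝟙 (does (j ≟F z))))
             (cong 𝟙 (dec-true (j ≟F j) refl)) (sumF-single (suc n) (λ z → 𝟙 (does (j ≟F z))) j)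

tripleTerm : ∀ {n} → Fin n → Fin n → Fin n → Fin n → ℕ
tripleTerm u x y z =
  if does (x <? y) ∧ does (y <? z) then 𝟙 (does (u ≟F x) ∨ does (u ≟F y) ∨ does (u ≟F z)) else 0

triplesThrough : ∀ n → Fin n → ℕ
triplesThrough n u = sumF³ n (tripleTerm u)

-- Split off the triples with smallest element zero; the others are the
-- triples of Fin n shifted by one.
slice₀ : ∀ n → Fin (suc n) → ℕ
slice₀ n u = sumF (suc n) (λ y → sumF (suc n) (tripleTerm u zero y))

slices₊ : ∀ n → Fin (suc n) → ℕ
slices₊ n u = sumF n (λ x → sumF (suc n) (λ y → sumF (suc n) (tripleTerm u (suc x) y)))

slices₊≥ : ∀ n (k : Fin n) → triplesThrough n k ≤ slices₊ n (suc k)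
slices₊≥ n k = sumF-mono n (λ x →
  ≤-trans (sumF-mono n (λ y → m≤n+m _ (tripleTerm (suc k) (suc x) (suc y) zero)))
          (m≤n+m _ (sumF (suc n) (tripleTerm (suc k) (suc x) zero))))

triplesThrough≥ : ∀ n (u : Fin (suc n)) → n C 2 ≤ triplesThrough (suc n) u
triplesThrough≥ n zero = begin
  n C 2                                  ≡⟨ pairs≡ n ⟨
  pairs n                                ≤⟨ m≤n+m _ (sumF (suc n) (tripleTerm zero zero zero)) ⟩
  slice₀ n zero                          ≤⟨ m≤m+n _ (slices₊ n zero) ⟩
  triplesThrough (suc n) zero            ∎
  where open ≤-Reasoning
triplesThrough≥ (suc n) (suc k) = begin
  suc n C 2                                          ≡⟨ pascal₂ n ⟨
  n + n C 2                                          ≤⟨ +-mono-≤ (pairsThrough≥ n k) (triplesThrough≥ n k) ⟩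
  pairsThrough (suc n) k + triplesThrough (suc n) k  ≤⟨ +-mono-≤ pairs-in-slice₀ (slices₊≥ (suc n) k) ⟩
  slice₀ (suc n) (suc k) + slices₊ (suc n) (suc k)   ∎
  where
  open ≤-Reasoning
  pairs-in-slice₀ : pairsThrough (suc n) k ≤ slice₀ (suc n) (suc k)
  pairs-in-slice₀ = m≤n+m _ (sumF (suc (suc n)) (tripleTerm (suc k) zero zero))

-- The 3-subsets containing u are exactly the triples counted above.
triplesContaining≥ : ∀ {n} (u : Fin n) → (n ∸ 1) C 2 ≤ sumTriples n (λ t → 𝟙 (memb u t))
triplesContaining≥ {suc n} u =
  subst (n C 2 ≤_) (sym (sumF³-cong (suc n) (atTriple-vertices _ _ (λ t → cong 𝟙 (memb-does u t)))))
    (triplesThrough≥ n u)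

hits-once : ∀ {n} (v : Fin n) → sumF n (λ x → 𝟙 (does (x ≟F v))) ≡ 1
hits-once {suc n} zero    = cong suc (trans (sumF-const n 0) (*-zeroʳ n))
hits-once {suc n} (suc v) = hits-once v

members≤3 : ∀ {n} (t : Triple n) → sumF n (λ x → 𝟙 (memb x t)) ≤ 3
members≤3 {n} t = begin
  sumF n (λ x → 𝟙 (memb x t))
    ≤⟨ sumF-mono n bound ⟩
  sumF n (λ x → hit (a t) x + (hit (b t) x + hit (c t) x))
    ≡⟨ sumF-+ n (hit (a t)) _ ⟩
  hits (a t) + sumF n (λ x → hit (b t) x + hit (c t) x)
    ≡⟨ cong (hits (a t) +_) (sumF-+ n (hit (b t)) (hit (c t))) ⟩
  hits (a t) + (hits (b t) + hits (c t))
    ≡⟨ cong₂ _+_ (hits-once (a t)) (cong₂ _+_ (hits-once (b t)) (hits-once (c t))) ⟩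
  3 ∎
  where
  open ≤-Reasoning
  hit : Fin n → Fin n → ℕ
  hit v x = 𝟙 (does (x ≟F v))
  hits : Fin n → ℕ
  hits v = sumF n (hit v)
  bound : ∀ x → 𝟙 (memb x t) ≤ hit (a t) x + (hit (b t) x + hit (c t) x)
  bound x rewrite memb-does x t =
    ≤-trans (𝟙-∨ (does (x ≟F a t)) _) (+-mono-≤ ≤-refl (𝟙-∨ (does (x ≟F b t)) _))

triple-≡ : ∀ {n} {s t : Triple n} → a s ≡ a t → b s ≡ b t → c s ≡ c t → s ≡ t
triple-≡ {s = tri x y z x<y y<z} {tri .x .y .z x<y′ y<z′} refl refl refl =
  cong₂ (tri x y z) (<-irrelevant x<y x<y′) (<-irrelevant y<z y<z′)

eqT-refl : ∀ {n} (t : Triple n) → eqT t t ≡ true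
eqT-refl t = cong₂ _∧_ (trans (isYes≡does (a t ≟F a t)) (dec-true (a t ≟F a t) refl))
                 (cong₂ _∧_ (trans (isYes≡does (b t ≟F b t)) (dec-true (b t ≟F b t) refl))
                            (trans (isYes≡does (c t ≟F c t)) (dec-true (c t ≟F c t) refl)))

eqT-sound : ∀ {n} (s t : Triple n) → eqT s t ≡ true → s ≡ t
eqT-sound s t same with a s ≟F a t | b s ≟F b t | c s ≟F c t
... | yes aₛ≡aₜ | yes bₛ≡bₜ | yes cₛ≡cₜ = triple-≡ aₛ≡aₜ bₛ≡bₜ cₛ≡cₜ

mistake : Bool → Bool → ℕ
mistake positive together =
  if positive then (if together then 0 else 1) else (if together then 1 else 0)

missed-or-joined : ∀ positive together → 𝟙 positive ≤ mistake positive together + 𝟙 (positive ∧ together)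
missed-or-joined true  true  = ≤-refl
missed-or-joined true  false = ≤-refl
missed-or-joined false _     = z≤n

module Errors {n : ℕ} (adj : Fin n → Fin n → Bool) (cl : HV n → ℕ) where

  errPair-distinct : ∀ v w → eqV v w ≡ false → errPair adj cl v w ≡ mistake (sign adj v w) (sameC cl v w)
  errPair-distinct v w v≢w = cong (λ e → if e then 0 else mistake (sign adj v w) (sameC cl v w)) v≢w

  together : ∀ v w → cl v ≡ cl w → sameC cl v w ≡ true
  together v w same = trans (isYes≡does (cl v ℕ.≟ cl w)) (dec-true (cl v ℕ.≟ cl w) same)

  together-sound : ∀ v w → sameC cl v w ≡ true → cl v ≡ cl w
  together-sound v w same with cl v ℕ.≟ cl w
  ... | yes v~w = v~w

  apart : ∀ v w → cl v ≢ cl w → sameC cl v w ≡ false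
  apart v w split = trans (isYes≡does (cl v ℕ.≟ cl w)) (dec-false (cl v ℕ.≟ cl w) split)

  split-error : ∀ t i j → cl (inj₂ (t , i)) ≢ cl (inj₂ (t , j)) →
                errPair adj cl (inj₂ (t , i)) (inj₂ (t , j)) ≡ 1
  split-error t i j split =
    trans (errPair-distinct (inj₂ (t , i)) (inj₂ (t , j))
             (trans (cong (_∧ ⌊ i ≟F j ⌋) (eqT-refl t))
                    (trans (isYes≡does (i ≟F j)) (dec-false (i ≟F j) (λ { refl → split refl })))))
          (cong₂ mistake (eqT-refl t) (apart (inj₂ (t , i)) (inj₂ (t , j)) split))

  merge-error : ∀ s t i j → eqT s t ≡ false → cl (inj₂ (s , i)) ≡ cl (inj₂ (t , j)) →
                errPair adj cl (inj₂ (s , i)) (inj₂ (t , j)) ≡ 1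
  merge-error s t i j s≢t merged =
    trans (errPair-distinct (inj₂ (s , i)) (inj₂ (t , j)) (cong (_∧ ⌊ i ≟F j ⌋) s≢t))
          (cong₂ mistake s≢t (together (inj₂ (s , i)) (inj₂ (t , j)) merged))

  cliqueErrors : HV n → Triple n → ℕ
  cliqueErrors v s = sumF 7 (λ j → errPair adj cl v (inj₂ (s , j)))

  allCliqueErrors≤errors : ∀ v → sumTriples n (cliqueErrors v) ≤ errors adj cl v
  allCliqueErrors≤errors v = m≤n+m _ (sumF n (λ x → errPair adj cl v (inj₁ x)))

  cliqueErrors≤errors : ∀ v s → cliqueErrors v s ≤ errors adj cl v
  cliqueErrors≤errors v s = ≤-trans (sumTriples-single n (cliqueErrors v) s) (allCliqueErrors≤errors v)

  joined : Fin n → Triple n → ℕ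
  joined u s = sumF 7 (λ j → 𝟙 (memb u s ∧ sameC cl (inj₁ u) (inj₂ (s , j))))

  unjoined-cost : ∀ u → 7 * sumTriples n (λ s → 𝟙 (memb u s)) ≤
                        errors adj cl (inj₁ u) + sumTriples n (joined u)
  unjoined-cost u = begin
    7 * sumTriples n (λ s → 𝟙 (memb u s))                       ≡⟨ sumTriples-scale n 7 _ ⟨
    sumTriples n (λ s → 7 * 𝟙 (memb u s))                       ≤⟨ sumTriples-mono n per-triple ⟩
    sumTriples n (λ s → cliqueErrors (inj₁ u) s + joined u s)   ≡⟨ sumTriples-+ n _ _ ⟩
    sumTriples n (cliqueErrors (inj₁ u)) + sumTriples n (joined u)
                                                                ≤⟨ +-mono-≤ (allCliqueErrors≤errors (inj₁ u)) ≤-refl ⟩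
    errors adj cl (inj₁ u) + sumTriples n (joined u)            ∎
    where
    open ≤-Reasoning
    per-triple : ∀ s → 7 * 𝟙 (memb u s) ≤ cliqueErrors (inj₁ u) s + joined u s
    per-triple s = subst (7 * 𝟙 (memb u s) ≤_)
      (sumF-+ 7 (λ j → errPair adj cl (inj₁ u) (inj₂ (s , j)))
                (λ j → 𝟙 (memb u s ∧ sameC cl (inj₁ u) (inj₂ (s , j)))))
      (sumF-mono 7 (λ j → missed-or-joined (memb u s) (sameC cl (inj₁ u) (inj₂ (s , j)))))

C₂-positive : ∀ {n} → 3 ≤ n → 1 ≤ (n ∸ 1) C 2
C₂-positive {suc (suc (suc m))} _ = subst (1 ≤_) (pascal₂ (suc m)) (s≤s z≤n)
C₂-positive {suc zero}       (s≤s ())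
C₂-positive {suc (suc zero)} (s≤s (s≤s ()))

-- t_u = 7 (C − 1) + 2 is less than 7 C, the cost of C unjoined triples.
tolerance<7C : ∀ C → 1 ≤ C → 7 * (C ∸ 1) + 2 < 7 * C
tolerance<7C (suc c) _ = begin-strict
  7 * c + 2    <⟨ +-monoʳ-< (7 * c) (s<s (s<s z<s)) ⟩
  7 * c + 7    ≡⟨ +-comm (7 * c) 7 ⟩
  7 + 7 * c    ≡⟨ *-suc 7 c ⟨
  7 * suc c    ∎
  where open ≤-Reasoning

apart-from-one : ∀ {p q : ℕ} → p ≢ q → ∀ r → (p ≢ r) ⊎ (q ≢ r)
apart-from-one {p} p≢q r with p ℕ.≟ r
... | yes p≡r = inj₂ (λ q≡r → p≢q (trans p≡r (sym q≡r)))
... | no  p≢r = inj₁ p≢r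

module Perfect {n : ℕ} (3≤n : 3 ≤ n) (adj : Fin n → Fin n → Bool) (cl : HV n → ℕ)
               (perfect : TPerfect adj cl) where
  open Errors adj cl

  cliqueErrors≤3 : ∀ t i s → cliqueErrors (inj₂ (t , i)) s ≤ 3
  cliqueErrors≤3 t i s = ≤-trans (cliqueErrors≤errors (inj₂ (t , i)) s) (perfect (inj₂ (t , i)))

  -- Each clique lies in one cluster: if (t , i) and (t , k) were apart, every
  -- vertex of C_t would be cut from one of them, giving 7 > 3 + 3 errors.
  clique-unsplit : ∀ t i k → cl (inj₂ (t , i)) ≡ cl (inj₂ (t , k))
  clique-unsplit t i k with cl (inj₂ (t , i)) ℕ.≟ cl (inj₂ (t , k))
  ... | yes i~k = i~k
  ... | no  i≁k =
    contradiction (≤-trans covered (+-mono-≤ (cliqueErrors≤3 t i t) (cliqueErrors≤3 t k t))) 1+n≰n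
    where
    err : Fin 7 → Fin 7 → ℕ
    err p j = errPair adj cl (inj₂ (t , p)) (inj₂ (t , j))
    cut-from-one : ∀ j → 1 ≤ err i j + err k j
    cut-from-one j with apart-from-one i≁k (cl (inj₂ (t , j)))
    ... | inj₁ i≁j = ≤-trans (≤-reflexive (sym (split-error t i j i≁j))) (m≤m+n _ (err k j))
    ... | inj₂ k≁j = ≤-trans (≤-reflexive (sym (split-error t k j k≁j))) (m≤n+m _ (err i j))
    covered : 7 ≤ cliqueErrors (inj₂ (t , i)) t + cliqueErrors (inj₂ (t , k)) t
    covered = subst (7 ≤_) (sumF-+ 7 (err i) (err k)) (sumF-mono 7 cut-from-one)

  -- A cluster meets at most one clique: a vertex of C_t clustered with C_s,
  -- s ≠ t, keeps seven − edges.
  one-clique-per-cluster : ∀ s j t i → cl (inj₂ (s , j)) ≡ cl (inj₂ (t , i)) → s ≡ t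
  one-clique-per-cluster s j t i s~t with eqT t s in t≟s
  ... | true  = sym (eqT-sound t s t≟s)
  ... | false = contradiction (≤-trans merged (cliqueErrors≤3 t i s)) (<⇒≱ (s<s (s<s (s<s z<s))))
    where
    merged : 7 ≤ cliqueErrors (inj₂ (t , i)) s
    merged = sumF-mono 7 (λ k → ≤-reflexive (sym
               (merge-error t s i k t≟s (trans (sym s~t) (clique-unsplit s j k)))))

  -- Every vertex u of G' shares its cluster with the clique of a triple
  -- containing u; otherwise u has 7 (n−1 choose 2) > t_u errors.
  anchored : ∀ u → ∃[ s ] ∃[ j ] ((memb u s ≡ true) × (cl (inj₂ (s , j)) ≡ cl (inj₁ u)))
  anchored u with sumTriples n (joined u) ℕ.≟ 0
  ... | no some with sumTriples-positive n (joined u) (n≢0⇒n>0 some)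
  ...   | s , joined-s
          with sumF-positive 7 (λ j → 𝟙 (memb u s ∧ sameC cl (inj₁ u) (inj₂ (s , j)))) joined-s
  ...     | j , joined-j with both-true joined-j
  ...       | u∈s , u~sj = s , j , u∈s , sym (together-sound (inj₁ u) (inj₂ (s , j)) u~sj)
  anchored u | yes none =
    contradiction (perfect (inj₁ u)) (<⇒≱ (≤-trans (tolerance<7C N (C₂-positive 3≤n)) too-many))
    where
    N : ℕ
    N = (n ∸ 1) C 2
    too-many : 7 * N ≤ errors adj cl (inj₁ u)
    too-many = begin
      7 * N                                              ≤⟨ *-monoʳ-≤ 7 (triplesContaining≥ u) ⟩
      7 * sumTriples n (λ s → 𝟙 (memb u s))              ≤⟨ unjoined-cost u ⟩
      errors adj cl (inj₁ u) + sumTriples n (joined u)   ≡⟨ cong (errors adj cl (inj₁ u) +_) none ⟩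
      errors adj cl (inj₁ u) + 0                         ≡⟨ +-identityʳ _ ⟩
      errors adj cl (inj₁ u)                             ∎
      where open ≤-Reasoning

  cluster-clique : ∀ v → ∃[ t ] ((∃[ i ] cl (inj₂ (t , i)) ≡ cl v) ×
                                 (∀ s j → cl (inj₂ (s , j)) ≡ cl v → s ≡ t))
  cluster-clique (inj₂ (t , i)) = t , (i , refl) , λ s j s~v → one-clique-per-cluster s j t i s~v
  cluster-clique (inj₁ u) with anchored u
  ... | t , i , _ , t~u = t , (i , t~u) , λ s j s~u → one-clique-per-cluster s j t i (trans s~u (sym t~u))

  -- The G'-vertices of a cluster lie in the triple of its clique, so there are
  -- at most three of them.
  cluster-G′≤3 : ∀ v → countG' cl v ≤ 3
  cluster-G′≤3 v with cluster-clique v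
  ... | t , _ , only-t = ≤-trans (sumF-mono n (λ x → 𝟙-mono (in-t x))) (members≤3 t)
    where
    in-t : ∀ x → sameC cl (inj₁ x) v ≡ true → memb x t ≡ true
    in-t x x~v with anchored x
    ... | s , j , x∈s , s~x =
      subst (λ r → memb x r ≡ true) (only-t s j (trans s~x (together-sound (inj₁ x) v x~v))) x∈s

lemma2 : (n : ℕ) → 7 ≤ n → (adj : Fin n → Fin n → Bool) → FourRegularGraph adj →
         (cl : HV n → ℕ) → TPerfect adj cl →
         (∀ v → countG' cl v ≤ 3) ×
         (∀ v → ∃[ t ] ((∃[ i ] cl (inj₂ (t , i)) ≡ cl v) ×
                        (∀ s j → cl (inj₂ (s , j)) ≡ cl v → s ≡ t)))
lemma2 n 7≤n adj _ cl perfect = cluster-G′≤3 , cluster-clique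
  where open Perfect (≤-trans (s≤s (s≤s (s≤s z≤n))) 7≤n) adj cl perfect
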